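{- Let $s,t$ be positive integers and define the sequence $(Q_n)_{n\ge0}$ of nonnegative integers as follows: for each $n\ge 0$, if $n=tQ_m+sm$ for some $m<n$ such that the value $Q_m$ occurs exactly once among $Q_0,\dots,Q_{n-1}$, then $Q_n=Q_m$; otherwise $Q_n=\operatorname{mex}\{Q_m:0\le m<n\}$. Let $Q^1$ be the subsequence of $Q$ consisting of the terms $Q_n$ that are the first occurrence of their value, and $Q^2$ the subsequence consisting of the terms $Q_n$ that are the second occurrence of their value. (i) If $Q_i=r$ and $Q_j=r+1$ are consecutive terms of $Q^2$ (at positions $i$ and $j$ of $Q$), then $j-i\ge2$. (ii) If $Q_i=r$ and $Q_j=r+1$ are consecutive terms of $Q^1$ (at positions $i$ and $j$ of $Q$), then $j-i\le2$.
   Context: For a finite set $S$ of nonnegative integers, $\operatorname{mex} S$ is the least nonnegative integer not in $S$ (so $\operatorname{mex}\emptyset=0$). -}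

module Defs where

open import Data.Nat using (ℕ; zero; suc; _+_; _*_; _<_; _≟_)
open import Data.List using (List; map; upTo; filter; length)
open import Data.List.Membership.Propositional using (_∈_; _∉_)
open import Data.Product using (Σ; _×_; ∃-syntax)
open import Data.Sum using (_⊎_)
open import Relation.Nullary using (¬_)
open import Relation.Binary.PropositionalEquality using (_≡_)

prefix : (ℕ → ℕ) → ℕ → List ℕ
prefix Q n = map Q (upTo n)

count : ℕ → List ℕ → ℕ
count v xs = length (filter (v ≟_) xs)

IsMex : List ℕ → ℕ → Set
IsMex xs v = v ∉ xs × (∀ k → k < v → k ∈ xs)

Witness : ℕ → ℕ → (ℕ → ℕ) → ℕ → ℕ → Set
Witness s t Q n m = m < n × n ≡ t * Q m + s * m × count (Q m) (prefix Q n) ≡ 1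

IsQ : ℕ → ℕ → (ℕ → ℕ) → Set
IsQ s t Q = ∀ n →
  (Σ ℕ λ m → Witness s t Q n m × Q n ≡ Q m)
  ⊎ ((¬ Σ ℕ λ m → Witness s t Q n m) × IsMex (prefix Q n) (Q n))

InQ1 : (ℕ → ℕ) → ℕ → Set
InQ1 Q n = Q n ∉ prefix Q n

InQ2 : (ℕ → ℕ) → ℕ → Set
InQ2 Q n = count (Q n) (prefix Q n) ≡ 1

Consecutive : (ℕ → Set) → ℕ → ℕ → Set
Consecutive P i j = i < j × P i × P j × (∀ k → i < k → k < j → ¬ P k)

{-# OPTIONS --safe #-}
-- A copy step n that copies Q_m sits at position n = t Q_m + s m, and the copied
-- index m is a first occurrence. First occurrences are mex steps, so along the
-- positions of Q¹ the values strictly increase; as s, t ≥ 1, copies of distinct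
-- first occurrences land at positions at least 2 apart, hence any two distinct
-- copy steps do. Second occurrences, and all terms that are not first
-- occurrences, are copy steps, which gives (i) and (ii). The values r and r + 1
-- play no role.
module Submission where

open import Defs
open import Data.Nat using (ℕ; suc; _+_; _*_; _≤_; _<_; _≤′_; ≤′-refl; ≤′-step; NonZero; z≤n; s≤s; _≟_; _≤?_)
open import Data.Nat.Properties
open import Data.List using (_∷_; _++_; [_]; map; upTo; filter; length)
open import Data.List.Properties using (map-++; upTo-∷ʳ; filter-++; length-++; filter-accept; filter-reject)
open import Data.List.Membership.Propositional using (_∈_)
open import Data.List.Membership.Propositional.Properties using (∈-map⁺; ∈-map⁻; ∈-upTo⁺; ∈-upTo⁻)
open import Data.List.Relation.Unary.Any using (here; there; tail)
open import Data.Product using (_×_; _,_; ∃-syntax)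
open import Data.Sum using (inj₁; inj₂)
open import Relation.Nullary using (¬_; yes; no; contradiction)
open import Relation.Binary.PropositionalEquality using (_≡_; refl; sym; trans; cong; subst)
open import Relation.Binary.Definitions using (tri<; tri≈; tri>)

count-++ : ∀ v xs ys → count v (xs ++ ys) ≡ count v xs + count v ys
count-++ v xs ys = trans (cong length (filter-++ (v ≟_) xs ys)) (length-++ (filter (v ≟_) xs))

∈⇒count-pos : ∀ {v xs} → v ∈ xs → 0 < count v xs
∈⇒count-pos {v} {x ∷ xs} v∈ with v ≟ x
... | yes v≡x rewrite filter-accept (v ≟_) {xs = xs} v≡x = s≤s z≤n
... | no v≢x  rewrite filter-reject (v ≟_) {xs = xs} v≢x = ∈⇒count-pos (tail v≢x v∈)

count-pos⇒∈ : ∀ {v xs} → 0 < count v xs → v ∈ xs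
count-pos⇒∈ {v} {x ∷ xs} pos with v ≟ x
... | yes v≡x = here v≡x
... | no v≢x  rewrite filter-reject (v ≟_) {xs = xs} v≢x = there (count-pos⇒∈ pos)

module _ (Q : ℕ → ℕ) where

  ∈-prefix⁺ : ∀ {k n} → k < n → Q k ∈ prefix Q n
  ∈-prefix⁺ k<n = ∈-map⁺ Q (∈-upTo⁺ k<n)

  ∈-prefix-mono : ∀ {v m n} → m ≤ n → v ∈ prefix Q m → v ∈ prefix Q n
  ∈-prefix-mono m≤n v∈ with _ , k∈ , refl ← ∈-map⁻ Q v∈ = ∈-prefix⁺ (<-≤-trans (∈-upTo⁻ k∈) m≤n)

  prefix-suc : ∀ n → prefix Q (suc n) ≡ prefix Q n ++ [ Q n ]
  prefix-suc n = trans (cong (map Q) (sym (upTo-∷ʳ n))) (map-++ Q (upTo n) [ n ])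

  count-prefix-suc : ∀ v n → count v (prefix Q (suc n)) ≡ count v (prefix Q n) + count v [ Q n ]
  count-prefix-suc v n = trans (cong (count v) (prefix-suc n)) (count-++ v (prefix Q n) [ Q n ])

  count-prefix-mono : ∀ {v m n} → m ≤ n → count v (prefix Q m) ≤ count v (prefix Q n)
  count-prefix-mono {v} m≤n = mono′ (≤⇒≤′ m≤n)
    where
    mono′ : ∀ {m n} → m ≤′ n → count v (prefix Q m) ≤ count v (prefix Q n)
    mono′ ≤′-refl            = ≤-refl
    mono′ (≤′-step {n} m≤′n) =
      ≤-trans (mono′ m≤′n) (subst (count v (prefix Q n) ≤_) (sym (count-prefix-suc v n)) (m≤m+n _ _))

witness-first-occurrence : ∀ s t Q {n m} → Witness s t Q n m → InQ1 Q m
witness-first-occurrence s t Q {n} {m} (m<n , _ , once) Qm∈ = 1+n≰n (begin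
  2                                              ≤⟨ +-mono-≤ (∈⇒count-pos Qm∈) (∈⇒count-pos {Q m} {[ Q m ]} (here refl)) ⟩
  count (Q m) (prefix Q m) + count (Q m) [ Q m ] ≡⟨ sym (count-prefix-suc Q (Q m) m) ⟩
  count (Q m) (prefix Q (suc m))                 ≤⟨ count-prefix-mono Q m<n ⟩
  count (Q m) (prefix Q n)                       ≡⟨ once ⟩
  1                                              ∎)
  where open ≤-Reasoning

module Recurrence (s t : ℕ) (Q : ℕ → ℕ) (isQ : IsQ s t Q) where

  Copied : ℕ → Set
  Copied n = ∃[ m ] Witness s t Q n m

  first-occurrence⇒mex : ∀ {n} → InQ1 Q n → ∀ k → k < Q n → k ∈ prefix Q n
  first-occurrence⇒mex {n} new with isQ n
  ... | inj₁ (m , (m<n , _) , Qn≡Qm) = contradiction (subst (_∈ prefix Q n) (sym Qn≡Qm) (∈-prefix⁺ Q m<n)) new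
  ... | inj₂ (_ , _ , below)         = below

  first-occurrences-increasing : ∀ {m m'} → InQ1 Q m → InQ1 Q m' → m < m' → Q m < Q m'
  first-occurrences-increasing {m} {m'} new new' m<m' with <-cmp (Q m) (Q m')
  ... | tri< Qm<Qm' _ _ = Qm<Qm'
  ... | tri≈ _ Qm≡Qm' _ = contradiction (subst (_∈ prefix Q m') Qm≡Qm' (∈-prefix⁺ Q m<m')) new'
  ... | tri> _ _ Qm'<Qm = contradiction
        (∈-prefix-mono Q (<⇒≤ m<m') (first-occurrence⇒mex new (Q m') Qm'<Qm)) new'

  ¬first-occurrence⇒copied : ∀ {n} → ¬ InQ1 Q n → Copied n
  ¬first-occurrence⇒copied {n} old with isQ n
  ... | inj₁ (m , w , _)   = m , w
  ... | inj₂ (_ , new , _) = contradiction new old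

  second-occurrence⇒copied : ∀ {n} → InQ2 Q n → Copied n
  second-occurrence⇒copied {n} once =
    ¬first-occurrence⇒copied (λ new → new (count-pos⇒∈ (subst (0 <_) (sym once) (s≤s z≤n))))

  module _ .{{_ : NonZero s}} .{{_ : NonZero t}} where

    witnessed-steps-apart : ∀ {n n' m m'} → Witness s t Q n m → Witness s t Q n' m' →
                            m < m' → 2 + n ≤ n'
    witnessed-steps-apart {n} {n'} {m} {m'} w@(_ , n≡ , _) w'@(_ , n'≡ , _) m<m' = begin
      2 + n                       ≡⟨ cong (2 +_) n≡ ⟩
      2 + (t * Q m + s * m)       ≡⟨ cong suc (sym (+-suc (t * Q m) (s * m))) ⟩
      suc (t * Q m) + suc (s * m) ≤⟨ +-mono-≤ (*-monoʳ-< t Qm<Qm') (*-monoʳ-< s m<m') ⟩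
      t * Q m' + s * m'           ≡⟨ sym n'≡ ⟩
      n'                          ∎
      where
      open ≤-Reasoning
      Qm<Qm' : Q m < Q m'
      Qm<Qm' = first-occurrences-increasing
        (witness-first-occurrence s t Q w) (witness-first-occurrence s t Q w') m<m'

    copied-apart : ∀ {n n'} → Copied n → Copied n' → n < n' → 2 + n ≤ n'
    copied-apart (m , w@(_ , n≡ , _)) (m' , w'@(_ , n'≡ , _)) n<n' with <-cmp m m'
    ... | tri< m<m' _ _ = witnessed-steps-apart w w' m<m'
    ... | tri≈ _ refl _ = contradiction (trans n≡ (sym n'≡)) (<⇒≢ n<n')
    ... | tri> _ _ m'<m = contradiction (m+n≤o⇒n≤o 2 (witnessed-steps-apart w' w m'<m)) (<⇒≱ n<n')

lemma3 : (s t : ℕ) → .{{NonZero s}} → .{{NonZero t}} →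
    (Q : ℕ → ℕ) → IsQ s t Q →
    (∀ i j r → Consecutive (InQ2 Q) i j → Q i ≡ r → Q j ≡ suc r → 2 + i ≤ j)
    × (∀ i j r → Consecutive (InQ1 Q) i j → Q i ≡ r → Q j ≡ suc r → j ≤ 2 + i)
lemma3 s t Q isQ = second-occurrences-apart , first-occurrences-close
  where
  open Recurrence s t Q isQ

  second-occurrences-apart : ∀ i j r → Consecutive (InQ2 Q) i j → Q i ≡ r → Q j ≡ suc r → 2 + i ≤ j
  second-occurrences-apart i j _ (i<j , once , once' , _) _ _ =
    copied-apart (second-occurrence⇒copied once) (second-occurrence⇒copied once') i<j

  first-occurrences-close : ∀ i j r → Consecutive (InQ1 Q) i j → Q i ≡ r → Q j ≡ suc r → j ≤ 2 + i
  first-occurrences-close i j _ (_ , _ , _ , between) _ _ with j ≤? 2 + i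
  ... | yes j≤2+i = j≤2+i
  ... | no j≰2+i = contradiction
    (copied-apart (copied (n<1+n i) (<-trans (n<1+n (suc i)) 2+i<j))
                  (copied (m<n⇒m<1+n (n<1+n i)) 2+i<j)
                  (n<1+n (suc i)))
    1+n≰n
    where
    2+i<j : 2 + i < j
    2+i<j = ≰⇒> j≰2+i
    copied : ∀ {k} → i < k → k < j → Copied k
    copied i<k k<j = ¬first-occurrence⇒copied (between _ i<k k<j)
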